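{- Let $T$ be a finite set, and let $a_t$ be an integer for every $t\in T$. Then there exists a finite holey subset $S$ of $\mathbb{Z}$ such that \[ \sum_{t\in T} f_{n+a_t} = \sum_{s\in S} f_{n+s} \] for every $n\in\mathbb{Z}$ which satisfies $n>\max\left(\{ -a_t \mid t\in T\}\cup\{ -s\mid s\in S\}\right)$.
   Context: A subset $S$ of $\mathbb{Z}$ is called holey if $s+1\notin S$ for every $s\in S$ (i.e., no two elements of $S$ are consecutive integers). $(f_1,f_2,f_3,\dots)$ denotes the Fibonacci sequence, defined by $f_1=f_2=1$ and $f_n=f_{n-1}+f_{n-2}$ for all integers $n\ge 3$; $f_m$ is only defined for positive integers $m$. -}

module Defs where

open import Data.Nat as ℕ using (ℕ; zero; suc)
open import Data.Integer as ℤ using (ℤ; ∣_∣; _+_; -_; _<_; 1ℤ)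
open import Data.List using (List; map)
open import Data.Nat.ListAction using (sum)
open import Data.List.Relation.Unary.All using (All)
open import Data.List.Relation.Unary.Unique.Propositional using (Unique)
open import Data.List.Membership.Propositional using (_∈_; _∉_)
open import Data.Product using (_×_)

-- Fibonacci: fib 1 = fib 2 = 1, fib (n+2) = fib (n+1) + fib n.
-- fib 0 = 0 is an auxiliary value; it is never used by the statement,
-- since all indices are guaranteed positive there.
fib : ℕ → ℕ
fib zero = zero
fib (suc zero) = suc zero
fib (suc (suc n)) = fib (suc n) ℕ.+ fib n

-- f_m for an integer m, only meaningful for m > 0 (used only when m > 0).
fibℤ : ℤ → ℕ
fibℤ m = fib ∣ m ∣

-- A finite set of integers, represented by a duplicate-free list, is holey
-- if it never contains both s and s+1.
Holey : List ℤ → Set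
Holey S = All (λ s → (s + 1ℤ) ∉ S) S

fibSum : ℤ → List ℤ → ℕ
fibSum n as = sum (map (λ a → fibℤ (n + a)) as)

Above : ℤ → List ℤ → Set
Above n xs = All (λ x → (- x) < n) xs

module Submission where

-- Extend the Fibonacci numbers to all of ℤ by running the
-- recurrence backwards; the extension F satisfies F(m+2) = F(m+1) + F(m) for
-- every integer m, and so does every shift s ↦ F(n + s).  For any such
-- "Fibonacci-like" function g, a multiset of offsets can be normalised by
-- inserting offsets one at a time into a list that is decreasing with gaps
-- of at least 2, using only the two carry rules
--     g(m+1) + g(m) = g(m+2)           (two neighbours merge),
--     g(m)   + g(m) = g(m+1) + g(m-2)  (a doubled offset splits),
-- so the sum Σ g(s) never changes.  The invariant "decreasing with gaps ≥ 2"
-- (Sparse) implies that the resulting list is duplicate-free and holey.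
-- Finally, for n above all offsets every index n + s is positive, where F
-- agrees with the ordinary Fibonacci numbers, so the two sums in the
-- theorem are the same natural number.

open import Defs
open import Data.Integer using (ℤ)
open import Data.List using (List)
open import Data.List.Relation.Unary.Unique.Propositional using (Unique)
open import Data.Product using (Σ; _×_)
open import Relation.Binary.PropositionalEquality using (_≡_)

open import Data.Nat using (ℕ; zero; suc)
import Data.Nat.Properties as ℕP
open import Data.Integer using (+_; -[1+_]; _+_; _-_; -_; _≤_; _<_; _≟_; _⊔_; pred; +<+)
import Data.Integer.Properties as ℤP
open import Data.Integer.Tactic.RingSolver using (solve-∀)
open import Data.List using ([]; _∷_)
open import Data.List.Relation.Unary.All as All using (All; []; _∷_)
open import Data.List.Relation.Unary.All.Properties using (All¬⇒¬Any)
open import Data.List.Relation.Unary.Any using (here; there)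
open import Data.List.Relation.Unary.AllPairs using ([]; _∷_)
open import Data.List.Membership.Propositional using (_∉_)
open import Data.Product using (_,_; ∃)
open import Data.Empty using (⊥)
open import Relation.Nullary using (yes; no)
open import Relation.Binary.PropositionalEquality
  using (_≢_; refl; sym; trans; cong; cong₂; subst; module ≡-Reasoning)
open import Algebra.Properties.CommutativeSemigroup ℤP.+-commutativeSemigroup
  using (x∙yz≈y∙xz; xy∙z≈y∙xz)
open ≡-Reasoning

FibLike : (ℤ → ℤ) → Set
FibLike g = ∀ m → g (m + + 2) ≡ g (m + + 1) + g m

-- fibNeg k = F(-k), obtained from the backward recurrence F(m) = F(m+2) - F(m+1).
fibNeg : ℕ → ℤ
fibNeg zero = + 0
fibNeg (suc zero) = + 1
fibNeg (suc (suc k)) = fibNeg k - fibNeg (suc k)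

fibExt : ℤ → ℤ
fibExt (+ k) = + fib k
fibExt -[1+ k ] = fibNeg (suc k)

-- a = x + (a - x); also the content of the backward recurrence.
add-difference : ∀ a x → a ≡ x + (a - x)
add-difference = solve-∀

-- The extension obeys the recurrence everywhere: on ℕ it is the definition of
-- fib, at m ≤ -3 the definition of fibNeg, and m = -1, -2 are checked directly.
fibExt-fibLike : FibLike fibExt
fibExt-fibLike (+ k) rewrite ℕP.+-comm k 2 | ℕP.+-comm k 1 = refl
fibExt-fibLike -[1+ 0 ] = refl
fibExt-fibLike -[1+ 1 ] = refl
fibExt-fibLike -[1+ suc (suc k) ] = add-difference (fibNeg (suc k)) (fibNeg (suc (suc k)))

shift-fibLike : ∀ {g} n → FibLike g → FibLike (λ s → g (n + s))
shift-fibLike {g} n rec m = begin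
  g (n + (m + + 2))            ≡⟨ cong g (sym (ℤP.+-assoc n m (+ 2))) ⟩
  g (n + m + + 2)              ≡⟨ rec (n + m) ⟩
  g (n + m + + 1) + g (n + m)  ≡⟨ cong (λ t → g t + g (n + m)) (ℤP.+-assoc n m (+ 1)) ⟩
  g (n + (m + + 1)) + g (n + m) ∎

-- The recurrence for three consecutive integers p, q = p+1, r = q+1,
-- with the indices given in whatever form they arise.
recurrence : ∀ {g} → FibLike g → ∀ p {q r} → p + + 1 ≡ q → q + + 1 ≡ r → g r ≡ g q + g p
recurrence {g} rec p refl refl = trans (cong g (ℤP.+-assoc p (+ 1) (+ 1))) (rec p)

double : ∀ {g} → FibLike g → ∀ m → g (m + + 1) + g (m - + 2) ≡ g m + g m
double {g} rec m = begin
  g (m + + 1) + g (m - + 2)          ≡⟨ cong (_+ g (m - + 2)) upper ⟩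
  (g m + g (m - + 1)) + g (m - + 2)  ≡⟨ ℤP.+-assoc (g m) _ _ ⟩
  g m + (g (m - + 1) + g (m - + 2))  ≡⟨ cong (_+_ (g m)) (sym lower) ⟩
  g m + g m                          ∎
  where
  pred+1 : ∀ m → m - + 1 + + 1 ≡ m
  pred+1 = solve-∀
  down : ∀ m → m - + 2 + + 1 ≡ m - + 1
  down = solve-∀
  upper : g (m + + 1) ≡ g m + g (m - + 1)
  upper = recurrence {g} rec (m - + 1) (pred+1 m) refl
  lower : g m ≡ g (m - + 1) + g (m - + 2)
  lower = recurrence {g} rec (m - + 2) (down m) (pred+1 m)

total : (ℤ → ℤ) → List ℤ → ℤ
total g [] = + 0
total g (s ∷ L) = g s + total g L

data Position (a x : ℤ) : Set where
  far-above  : x + + 2 ≤ a → Position a x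
  next-above : a ≡ x + + 1 → Position a x
  equal      : a ≡ x → Position a x
  next-below : x ≡ a + + 1 → Position a x
  far-below  : a + + 2 ≤ x → Position a x

two-below : ∀ i k {j} → j ≡ i + + suc (suc k) → i + + 2 ≤ j
two-below i k {j} e = ℤP.≤-trans (ℤP.i≤i+j (i + + 2) (+ k)) (ℤP.≤-reflexive (sym j≡))
  where
  j≡ : j ≡ i + + 2 + + k
  j≡ = trans e (sym (ℤP.+-assoc i (+ 2) (+ k)))

subtract-difference : ∀ a x → x ≡ a + - (a - x)
subtract-difference = solve-∀

position : ∀ a x → Position a x
position a x with a - x in eq
... | + suc (suc k) = far-above (two-below x k (trans (add-difference a x) (cong (_+_ x) eq)))
... | + 1 = next-above (trans (add-difference a x) (cong (_+_ x) eq))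
... | + 0 = equal (trans (add-difference a x) (trans (cong (_+_ x) eq) (ℤP.+-identityʳ x)))
... | -[1+ 0 ] = next-below (trans (subtract-difference a x) (cong (λ d → a + - d) eq))
... | -[1+ suc k ] = far-below (two-below a k (trans (subtract-difference a x) (cong (λ d → a + - d) eq)))

attach : ℤ → List ℤ → List ℤ
attach x [] = x ∷ []
attach x (y ∷ R) with y + + 1 ≟ x
... | yes _ = (x + + 1) ∷ R
... | no _ = x ∷ y ∷ R

-- Insert the offset a into a list that is decreasing with gaps ≥ 2,
-- carrying with the two rules of the recurrence when a collides with an entry.
insert : ℤ → List ℤ → List ℤ
insert a [] = a ∷ []
insert a (x ∷ L) with position a x
... | far-above _ = a ∷ x ∷ L
... | next-above refl = (a + + 1) ∷ L
... | equal refl = (x + + 1) ∷ insert (x - + 2) L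
... | next-below refl = (x + + 1) ∷ L
... | far-below _ = attach x (insert a L)

normalize : List ℤ → List ℤ
normalize [] = []
normalize (a ∷ as) = insert a (normalize as)

expand-head : ∀ {p} u v T → p ≡ u + v → p + T ≡ u + (v + T)
expand-head u v T e = trans (cong (_+ T) e) (ℤP.+-assoc u v T)

module _ {g : ℤ → ℤ} (rec : FibLike g) where

  attach-total : ∀ x R → total g (attach x R) ≡ g x + total g R
  attach-total x [] = refl
  attach-total x (y ∷ R) with y + + 1 ≟ x
  ... | yes refl = expand-head (g (y + + 1)) (g y) (total g R) (recurrence {g} rec y refl refl)
  ... | no _ = refl

  insert-total : ∀ a L → total g (insert a L) ≡ g a + total g L
  insert-total a [] = refl
  insert-total a (x ∷ L) with position a x
  ... | far-above _ = refl
  ... | next-above refl = expand-head (g (x + + 1)) (g x) (total g L) (recurrence {g} rec x refl refl)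
  ... | equal refl = begin
    g (x + + 1) + total g (insert (x - + 2) L)  ≡⟨ cong (_+_ (g (x + + 1))) (insert-total (x - + 2) L) ⟩
    g (x + + 1) + (g (x - + 2) + total g L)     ≡⟨ sym (ℤP.+-assoc (g (x + + 1)) _ _) ⟩
    (g (x + + 1) + g (x - + 2)) + total g L     ≡⟨ expand-head (g x) (g x) _ (double {g} rec x) ⟩
    g x + (g x + total g L)                     ∎
  ... | next-below refl =
    trans (cong (_+ total g L) (recurrence {g} rec a refl refl)) (xy∙z≈y∙xz (g (a + + 1)) (g a) _)
  ... | far-below _ = begin
    total g (attach x (insert a L))  ≡⟨ attach-total x (insert a L) ⟩
    g x + total g (insert a L)       ≡⟨ cong (_+_ (g x)) (insert-total a L) ⟩
    g x + (g a + total g L)          ≡⟨ x∙yz≈y∙xz (g x) (g a) (total g L) ⟩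
    g a + (g x + total g L)          ∎

  normalize-total : ∀ as → total g (normalize as) ≡ total g as
  normalize-total [] = refl
  normalize-total (a ∷ as) = trans (insert-total a (normalize as)) (cong (_+_ (g a)) (normalize-total as))

-- Sparse b L: every entry of L is at least 2 below its predecessor,
-- the first entry being compared with the bound b.
data Sparse : ℤ → List ℤ → Set where
  []  : ∀ {b} → Sparse b []
  _∷_ : ∀ {b x L} → x + + 2 ≤ b → Sparse x L → Sparse b (x ∷ L)

sparse-weaken : ∀ {b c L} → b ≤ c → Sparse b L → Sparse c L
sparse-weaken b≤c [] = []
sparse-weaken b≤c (hx ∷ hL) = ℤP.≤-trans hx b≤c ∷ hL

≤-step : ∀ {i j} → i ≤ j → i ≤ j + + 1
≤-step {j = j} i≤j = ℤP.≤-trans i≤j (ℤP.i≤i+j j (+ 1))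

raise : ∀ y k {b} → y + k ≤ b → y + + 1 + k ≤ b + + 1
raise y k h = subst (_≤ _) (right-comm y k) (ℤP.+-monoˡ-≤ (+ 1) h)
  where
  right-comm : ∀ y k → y + k + + 1 ≡ y + + 1 + k
  right-comm = solve-∀

gap-step : ∀ {x y} → y + + 2 ≤ x + + 1 → y + + 1 ≢ x → y + + 2 ≤ x
gap-step {x} {y} hy ne =
  subst (_ ≤_) (pred-suc x) (ℤP.i<j⇒i≤pred[j] (ℤP.≤∧≢⇒< hy y+2≢x+1))
  where
  pred-suc : ∀ i → pred (i + + 1) ≡ i
  pred-suc i = cancel i
    where
    cancel : ∀ i → - + 1 + (i + + 1) ≡ i
    cancel = solve-∀
  y+2≢x+1 : y + + 2 ≢ x + + 1
  y+2≢x+1 e = ne (begin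
    y + + 1                ≡⟨ sym (pred-suc (y + + 1)) ⟩
    pred (y + + 1 + + 1)   ≡⟨ cong pred (ℤP.+-assoc y (+ 1) (+ 1)) ⟩
    pred (y + + 2)         ≡⟨ cong pred e ⟩
    pred (x + + 1)         ≡⟨ pred-suc x ⟩
    x                      ∎)

attach-sparse : ∀ {b x} R → x + + 2 ≤ b → Sparse (x + + 1) R → Sparse (b + + 1) (attach x R)
attach-sparse [] hx [] = ≤-step hx ∷ []
attach-sparse {x = x} (y ∷ R) hx (hy ∷ hR) with y + + 1 ≟ x
... | yes refl = raise (y + + 1) (+ 2) hx ∷ sparse-weaken (≤-step (≤-step ℤP.≤-refl)) hR
... | no ne = ≤-step hx ∷ gap-step {x} {y} hy ne ∷ hR

insert-sparse : ∀ {b} a L → a + + 2 ≤ b → Sparse b L → Sparse (b + + 1) (insert a L)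
insert-sparse a [] ha [] = ≤-step ha ∷ []
insert-sparse a (x ∷ L) ha (hx ∷ hL) with position a x
... | far-above x+2≤a = ≤-step ha ∷ x+2≤a ∷ hL
... | next-above refl = raise a (+ 2) ha ∷ sparse-weaken (≤-step (≤-step ℤP.≤-refl)) hL
... | equal refl = raise x (+ 2) hx ∷ insert-sparse (x - + 2) L (ℤP.≤-reflexive (back x)) hL
  where
  back : ∀ x → x - + 2 + + 2 ≡ x
  back = solve-∀
... | next-below refl = raise (a + + 1) (+ 2) hx ∷ sparse-weaken (≤-step ℤP.≤-refl) hL
... | far-below a+2≤x = attach-sparse (insert a L) hx (insert-sparse a L a+2≤x hL)

normalize-sparse : ∀ as → ∃ (λ b → Sparse b (normalize as))
normalize-sparse [] = + 0 , []
normalize-sparse (a ∷ as) with normalize-sparse as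
... | b , h = b ⊔ (a + + 2) + + 1 ,
  insert-sparse a (normalize as) (ℤP.i≤j⊔i b (a + + 2)) (sparse-weaken (ℤP.i≤i⊔j b (a + + 2)) h)

sparse-below : ∀ {b L} → Sparse b L → All (λ y → y + + 2 ≤ b) L
sparse-below [] = []
sparse-below (hx ∷ hL) =
  hx ∷ All.map (λ hy → ℤP.≤-trans hy (ℤP.≤-trans (ℤP.i≤i+j _ (+ 2)) hx)) (sparse-below hL)

too-close : ∀ {x} y → y + + 2 ≤ x → x ≤ y + + 1 → ⊥
too-close y y+2≤x x≤y+1 =
  ℤP.≤⇒≯ (ℤP.≤-trans y+2≤x x≤y+1) (ℤP.+-monoʳ-< y (+<+ (ℕP.n<1+n 1)))

sparse-unique : ∀ {b L} → Sparse b L → Unique L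
sparse-unique [] = []
sparse-unique (_ ∷ hL) =
  All.map (λ { {y} hy refl → too-close y hy (≤-step ℤP.≤-refl) }) (sparse-below hL)
  ∷ sparse-unique hL

sparse-holey : ∀ {b L} → Sparse b L → Holey L
sparse-holey [] = []
sparse-holey {L = x ∷ L} (_ ∷ hL) =
  head-holey ∷ All.zipWith (λ { {s} (hs , ns) → tail-holey s hs ns }) (sparse-below hL , sparse-holey hL)
  where
  head-holey : x + + 1 ∉ x ∷ L
  head-holey (here e) = ℤP.i≢suc[i] (trans (sym e) (ℤP.+-comm x (+ 1)))
  head-holey (there m) = All¬⇒¬Any (All.map not-successor (sparse-below hL)) m
    where
    not-successor : ∀ {y} → y + + 2 ≤ x → x + + 1 ≢ y
    not-successor hy refl = too-close (x + + 1) hy (≤-step (≤-step ℤP.≤-refl))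
  tail-holey : ∀ s → s + + 2 ≤ x → s + + 1 ∉ L → s + + 1 ∉ x ∷ L
  tail-holey s hs _ (here e) = too-close s hs (ℤP.≤-reflexive (sym e))
  tail-holey _ _ ns (there m) = ns m

fibExt-nonneg : ∀ {m} → + 0 ≤ m → fibExt m ≡ + fibℤ m
fibExt-nonneg {+ k} _ = refl

index-nonneg : ∀ {n} s → - s < n → + 0 ≤ n + s
index-nonneg {n} s h =
  subst (_≤ n + s) (ℤP.+-inverseˡ s) (ℤP.+-monoˡ-≤ s (ℤP.<⇒≤ h))

fibSum-total : ∀ n L → Above n L → + fibSum n L ≡ total (λ s → fibExt (n + s)) L
fibSum-total n [] [] = refl
fibSum-total n (s ∷ L) (h ∷ hs) =
  cong₂ _+_ (sym (fibExt-nonneg (index-nonneg s h))) (fibSum-total n L hs)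

theorem8 : (as : List ℤ) →
    Σ (List ℤ) (λ S → Unique S × Holey S ×
      ((n : ℤ) → Above n as → Above n S → fibSum n as ≡ fibSum n S))
theorem8 as with normalize-sparse as
... | _ , sparse = normalize as , sparse-unique sparse , sparse-holey sparse , same-sum
  where
  same-sum : (n : ℤ) → Above n as → Above n (normalize as) → fibSum n as ≡ fibSum n (normalize as)
  same-sum n above-as above-S = ℤP.+-injective (begin
    + fibSum n as           ≡⟨ fibSum-total n as above-as ⟩
    total g as              ≡⟨ sym (normalize-total (shift-fibLike {fibExt} n fibExt-fibLike) as) ⟩
    total g (normalize as)  ≡⟨ sym (fibSum-total n (normalize as) above-S) ⟩
    + fibSum n (normalize as) ∎)
    where
    g : ℤ → ℤ
    g s = fibExt (n + s)
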